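{- Let $p$ be an odd prime and let $k,n$ be positive integers with $n\mid p-1$. Let $d=\frac{p^{(p-1)k}-1}{p^k-1}+1$, and let $\mu_n$ denote the set of all $n$-th roots of unity. Let $a\in\mathbb{F}_{p^{(p-1)k}}$ satisfy $a^{p^k-1}\in\mu_n\setminus\{1\}$. Then $a^{ -1}x^d$ is a complete permutation polynomial over $\mathbb{F}_{p^{(p-1)k}}$.
   Context: A polynomial $f\in\mathbb{F}_Q[x]$ is a permutation polynomial of $\mathbb{F}_Q$ if it induces a bijection of $\mathbb{F}_Q$. It is a complete permutation polynomial (CPP) over $\mathbb{F}_Q$ if both $f(x)$ and $f(x)+x$ are permutation polynomials of $\mathbb{F}_Q$. -}

module Defs where

open import Level using (0ℓ)
open import Data.Nat using (ℕ; zero; suc)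
open import Data.Fin using (Fin)
open import Data.Product using (_×_)
open import Relation.Nullary using (¬_)
open import Relation.Binary.PropositionalEquality using (_≡_)
open import Algebra.Core using (Op₁; Op₂)
open import Function.Bundles using (_↔_)
import Algebra.Structures as S
import Function.Definitions as FD

-- Since the finite field of order q is unique up to isomorphism, quantifying
-- over all such records faithfully represents "F_q".
record FiniteField (q : ℕ) : Set₁ where
  infixl 7 _*_
  infixl 6 _+_
  field
    Carrier : Set
    _+_ : Op₂ Carrier
    _*_ : Op₂ Carrier
    -_  : Op₁ Carrier
    0#  : Carrier
    1#  : Carrier
    _⁻¹ : Op₁ Carrier
    isCommutativeRing : S.IsCommutativeRing {A = Carrier} _≡_ _+_ _*_ -_ 0# 1#
    0≢1 : ¬ (0# ≡ 1#)
    ⁻¹-inverse : ∀ x → ¬ (x ≡ 0#) → x * (x ⁻¹) ≡ 1#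
    ⁻¹-zero : 0# ⁻¹ ≡ 0#
    card : Carrier ↔ Fin q

  infixr 8 _^_
  _^_ : Carrier → ℕ → Carrier
  x ^ zero  = 1#
  x ^ suc n = x * (x ^ n)

  InMu : ℕ → Carrier → Set
  InMu n y = y ^ n ≡ 1#

  IsPermutation : (Carrier → Carrier) → Set
  IsPermutation f = FD.Bijective _≡_ _≡_ f

  IsCPP : (Carrier → Carrier) → Set
  IsCPP f = IsPermutation f × IsPermutation (λ x → f x + x)

-- Let Q = p ^ k, m = p - 1, q = Q ^ m, R = Q - 1 and S = (q - 1) / R = 1 + Q + … + Q ^ (m - 1),
-- so d = S + 1 and x ↦ x ^ S is the norm from F_q to its subfield F_Q. Since S ≡ m (mod R), the
-- exponent d ≡ p (mod R) is prime to q - 1, so f x = a⁻¹ x ^ d permutes F_q.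
-- For g x = f x + x we have a g x = x (x ^ S + a), whose S-th power is Φ (x ^ S) with
-- Φ u = u (u + a) ^ S. Put ω = a ^ R ∈ μ_m, of order r, and c = (- a) ^ r. For u ∈ F_Q the
-- conjugates of u + a are the u + a ω ^ j, so Φ u = u (u ^ r - c) ^ (m / r).
-- As ω ≠ 1, c is not an r-th power in F_Q. For u ∈ F_Q^×, w = c / (u ^ r - c) is a root of
-- T X ^ p - c ^ p (X + 1) with T = Φ u ^ r; two such roots differ by a root of
-- T X ^ p = c ^ p X, and a nonzero one would produce an r-th root of c in F_Q. Hence Φ is
-- injective on F_Q^×, which determines x ^ S and then x from g x.

{-# OPTIONS --safe #-}
module Submission where

open import Defs
open import Data.Nat using (ℕ; _∸_; _≤_; NonZero)
open import Data.Nat as ℕ using ()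
open import Data.Nat.Divisibility using (_∣_)
open import Data.Nat.Primality using (Prime)
open import Relation.Nullary using (¬_)
open import Relation.Binary.PropositionalEquality using (_≡_)

module Arithmetic where

  open import Data.Nat
  open import Data.Nat.Properties
  open import Data.Nat.Divisibility
  open import Data.Nat.Primality
  open import Data.Nat.Coprimality using (Coprime; coprime-divisor)
  open import Data.Nat.Combinatorics using (_C_; nCk≡n!/k![n-k]!; k![n∸k]!∣n!)
  open import Data.Nat.DivMod using (m/n*n≡m)
  open import Data.Nat.Tactic.RingSolver using (solve-∀)
  open import Data.Product using (∃-syntax; _×_; _,_)
  open import Data.Sum using (inj₁; inj₂)
  open import Relation.Nullary using (yes; no; contradiction)
  open import Relation.Unary using (Decidable)
  open import Relation.Binary.PropositionalEquality

  suc[n∸1]≡n : ∀ {n} → n ≢ 0 → suc (n ∸ 1) ≡ n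
  suc[n∸1]≡n {zero}  n≢0 = contradiction refl n≢0
  suc[n∸1]≡n {suc n} _   = refl

  module _ {P : ℕ → Set} (P? : Decidable P) where

    Minimal : Set
    Minimal = ∃[ r ] P r × (∀ {j} → j < r → ¬ P j)

    minimal : ∀ {n} → P n → Minimal
    minimal {n} Pn = search 0 n (λ ()) (subst P (sym (+-identityʳ n)) Pn)
      where
      search : ∀ i d → (∀ {j} → j < i → ¬ P j) → P (d + i) → Minimal
      search i d below Pd+i with P? i
      ... | yes Pi = i , Pi , below
      search i zero    below Pi   | no ¬Pi = contradiction Pi ¬Pi
      search i (suc d) below Pd+i | no ¬Pi = search (suc i) d below′ (subst P (sym (+-suc d i)) Pd+i)
        where
        below′ : ∀ {j} → j < suc i → ¬ P j
        below′ j<1+i with m<1+n⇒m<n∨m≡n j<1+i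
        ... | inj₁ j<i  = below j<i
        ... | inj₂ refl = ¬Pi

  prime∤! : ∀ {p} → Prime p → ∀ {j} → j < p → p ∤ j !
  prime∤! p-prime {zero}  _   p∣1 = ¬prime[1] (subst Prime (∣1⇒≡1 p∣1) p-prime)
  prime∤! p-prime {suc j} j<p p∣j! with euclidsLemma (suc j) (j !) p-prime p∣j!
  ... | inj₁ p∣1+j = <⇒≱ j<p (∣⇒≤ p∣1+j)
  ... | inj₂ p∣j!  = prime∤! p-prime (<-trans (n<1+n j) j<p) p∣j!

  prime∣C : ∀ {p k} → Prime p → 0 < k → k < p → p ∣ p C k
  prime∣C {p@(suc p′)} {k} p-prime 0<k k<p
    with euclidsLemma (p C k) (k ! * (p ∸ k) !) p-prime p∣product
    where
    instance _ = k !* (p ∸ k) !≢0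
    p∣product : p ∣ (p C k) * (k ! * (p ∸ k) !)
    p∣product = subst (p ∣_) (sym p!≡) (m∣m*n (p′ !))
      where
      p!≡ : (p C k) * (k ! * (p ∸ k) !) ≡ p !
      p!≡ = trans (cong (_* (k ! * (p ∸ k) !)) (nCk≡n!/k![n-k]! (<⇒≤ k<p)))
                  (m/n*n≡m (k![n∸k]!∣n! (<⇒≤ k<p)))
  ... | inj₁ p∣C = p∣C
  ... | inj₂ p∣k!*[p∸k]! with euclidsLemma (k !) ((p ∸ k) !) p-prime p∣k!*[p∸k]!
  ...   | inj₁ p∣k!      = contradiction p∣k! (prime∤! p-prime k<p)
  ...   | inj₂ p∣[p∸k]!  = contradiction p∣[p∸k]! (prime∤! p-prime (∸-monoʳ-< 0<k (<⇒≤ k<p)))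

  geometric : ℕ → ℕ → ℕ
  geometric Q zero    = 0
  geometric Q (suc i) = 1 + Q * geometric Q i

  geometric-pow : ∀ R i → suc (R * geometric (suc R) i) ≡ suc R ^ i
  geometric-pow R zero    = cong suc (*-zeroʳ R)
  geometric-pow R (suc i) =
    trans (step R (geometric (suc R) i)) (cong (suc R *_) (geometric-pow R i))
    where
    step : ∀ R g → suc (R * (1 + suc R * g)) ≡ suc R * suc (R * g)
    step = solve-∀

  geometric-mod : ∀ R i → ∃[ h ] geometric (suc R) i ≡ i + R * h
  geometric-mod R zero = 0 , sym (*-zeroʳ R)
  geometric-mod R (suc i) with h , g≡ ← geometric-mod R i =
    h + i + R * h , trans (cong (λ g → 1 + suc R * g) g≡) (step R i h)
    where
    step : ∀ R i h → 1 + suc R * (i + R * h) ≡ suc i + R * (h + i + R * h)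
    step = solve-∀

  coprime-suc : ∀ n → Coprime (suc n) n
  coprime-suc n {d} (d∣1+n , d∣n) = ∣1⇒≡1 (∣m+n∣m⇒∣n (subst (d ∣_) (+-comm 1 n) d∣1+n) d∣n)

  coprime-+* : ∀ {a n} h → Coprime a n → Coprime (a + n * h) n
  coprime-+* {a} {n} h a⊥n {d} (d∣a+nh , d∣n) =
    a⊥n (∣m+n∣m⇒∣n (subst (d ∣_) (+-comm a (n * h)) d∣a+nh) (∣m⇒∣m*n h d∣n) , d∣n)

  coprime-* : ∀ {m n o} → Coprime m n → Coprime m o → Coprime m (n * o)
  coprime-* {m} {n} m⊥n m⊥o {d} (d∣m , d∣no) = m⊥o (d∣m , coprime-divisor d⊥n d∣no)
    where
    d⊥n : Coprime d n
    d⊥n (e∣d , e∣n) = m⊥n (∣-trans e∣d d∣m , e∣n)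

  coprime-pred-pow : ∀ {p k R} → 1 ≤ k → suc R ≡ p ^ k → Coprime p R
  coprime-pred-pow {p} {suc k} {R} _ 1+R≡ {d} (d∣p , d∣R) =
    ∣1⇒≡1 (∣m+n∣m⇒∣n (subst (d ∣_) (trans (sym 1+R≡) (+-comm 1 R)) d∣p^[1+k]) d∣R)
    where
    d∣p^[1+k] : d ∣ p ^ suc k
    d∣p^[1+k] = ∣-trans d∣p (m∣m*n (p ^ k))

module Counting where

  open import Data.Nat using (suc)
  open import Data.Nat.Properties using (1+n≰n)
  open import Data.Fin using (Fin; punchOut; _≟_)
  open import Data.Fin.Properties using (any?; punchOut-injective; injective⇒≤)
  open import Data.Product using (∃-syntax; _,_)
  open import Function.Definitions using (Injective)
  open import Relation.Nullary using (yes; no; contradiction)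
  open import Relation.Binary.PropositionalEquality using (_≢_; sym)

  Fin-injective⇒surjective : ∀ {n} {f : Fin n → Fin n} → Injective _≡_ _≡_ f →
                             ∀ y → ∃[ x ] f x ≡ y
  Fin-injective⇒surjective {suc n} {f} f-inj y with any? (λ x → f x ≟ y)
  ... | yes hit = hit
  ... | no miss = contradiction (injective⇒≤ g-inj) 1+n≰n
    where
    y≢f : ∀ x → y ≢ f x
    y≢f x y≡fx = miss (x , sym y≡fx)
    g : Fin (suc n) → Fin n
    g x = punchOut (y≢f x)
    g-inj : Injective _≡_ _≡_ g
    g-inj {x} {x′} gx≡gx′ = f-inj (punchOut-injective (y≢f x) (y≢f x′) gx≡gx′)

module FiniteFieldProperties {q : ℕ} (F : FiniteField q) where

  open import Level using (0ℓ)
  open import Data.Nat as ℕ using (zero; suc)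
  import Data.Nat.Properties as ℕ
  open import Data.Nat.Divisibility using (_∣_; divides; m%n≡0⇒n∣m)
  open import Data.Nat.DivMod using (m≡m%n+[m/n]*n; m%n<n)
  open Arithmetic using (geometric)
  open import Relation.Binary.Definitions using (tri<; tri≈; tri>)
  open import Data.Nat.Coprimality using (Coprime; coprime-Bézout)
  open import Data.Nat.GCD using (module Bézout)
  open import Data.Fin as Fin using (Fin)
  open import Data.Fin.Permutation using (Permutation; permutation)
  open import Data.Vec.Functional using (Vector; tail)
  import Data.Fin.Properties as Fin
  open import Data.Product using (∃-syntax; _,_)
  open import Data.Sum using (_⊎_; inj₁; inj₂)
  open import Function.Base using (_∘_; id)
  open import Function.Bundles using (Inverse; Injection)
  open import Function.Definitions using (Injective)
  open import Function.Properties.Inverse using (Inverse⇒Injection)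
  open import Algebra.Bundles using (CommutativeRing; CommutativeMonoid)
  import Algebra.Properties.Group
  import Algebra.Properties.CommutativeSemiring.Exp
  import Algebra.Properties.CommutativeMonoid.Sum
  open import Algebra.Core using (Op₂)
  open import Algebra.Structures using (IsCommutativeMonoid)
  open import Relation.Nullary using (yes; no; contradiction)
  open import Relation.Nullary.Decidable using (via-injection)
  open import Relation.Binary.Definitions using (DecidableEquality)
  open import Relation.Binary.PropositionalEquality
  open ≡-Reasoning
  open Counting

  open FiniteField F public
  open Inverse card using (to; from; strictlyInverseˡ; strictlyInverseʳ)

  commutativeRing : CommutativeRing 0ℓ 0ℓ
  commutativeRing = record { isCommutativeRing = isCommutativeRing }

  open CommutativeRing commutativeRing public
    using ( +-comm; +-identityˡ; +-identityʳ; -‿inverseˡ; -‿inverseʳ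
          ; *-assoc; *-comm; *-identityˡ; *-identityʳ; distribˡ; distribʳ; zeroˡ; zeroʳ
          ; ring; +-group; semiring; commutativeSemiring )
  open import Algebra.Properties.Ring ring public
    using (-‿distribˡ-*; -‿distribʳ-*; -‿involutive; -0#≈0#)
  private module +-Group = Algebra.Properties.Group +-group
  open +-Group public
    using () renaming (inverseˡ-unique to x+y≡0⇒x≡-y; x∙y⁻¹≈ε⇒x≈y to x-y≡0⇒x≡y)
  open import Algebra.Properties.Quasigroup +-Group.quasigroup public
    using () renaming (cancelˡ to +-cancelˡ; cancelʳ to +-cancelʳ)
  private module Exp = Algebra.Properties.CommutativeSemiring.Exp commutativeSemiring
  open import Algebra.Properties.CommutativeSemigroup
    (CommutativeRing.*-commutativeSemigroup commutativeRing) public using (interchange; x∙yz≈y∙xz)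

  infix 4 _≟_
  _≟_ : DecidableEquality Carrier
  _≟_ = via-injection (Inverse⇒Injection card) Fin._≟_

  to-injective : Injective _≡_ _≡_ to
  to-injective = Injection.injective (Inverse⇒Injection card)

  injective⇒permutation : ∀ {h} → Injective _≡_ _≡_ h → IsPermutation h
  injective⇒permutation {h} h-inj = h-inj , surjective
    where
    h′-inj : Injective _≡_ _≡_ (λ i → to (h (from i)))
    h′-inj {i} {j} h′i≡h′j = begin
      i               ≡⟨ strictlyInverseˡ i ⟨
      to (from i)     ≡⟨ cong to (h-inj (to-injective h′i≡h′j)) ⟩
      to (from j)     ≡⟨ strictlyInverseˡ j ⟩
      j               ∎
    surjective : ∀ y → ∃[ x ] (∀ {z} → z ≡ x → h z ≡ y)
    surjective y with i , h′i≡ ← Fin-injective⇒surjective h′-inj (to y) =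
      from i , λ { refl → to-injective h′i≡ }

  [x-y]+y≡x : ∀ x y → (x + - y) + y ≡ x
  [x-y]+y≡x x y = +-Group.//-rightDividesˡ y x

  1#≢0# : 1# ≢ 0#
  1#≢0# = 0≢1 ∘ sym

  ⁻¹-inverseˡ : ∀ {x} → x ≢ 0# → x ⁻¹ * x ≡ 1#
  ⁻¹-inverseˡ {x} x≢0 = trans (*-comm _ x) (⁻¹-inverse x x≢0)

  *-cancelˡ : ∀ {x y z} → x ≢ 0# → x * y ≡ x * z → y ≡ z
  *-cancelˡ {x} {y} {z} x≢0 xy≡xz = begin
    y                ≡⟨ *-identityˡ y ⟨
    1# * y           ≡⟨ cong (_* y) (⁻¹-inverseˡ x≢0) ⟨
    (x ⁻¹ * x) * y   ≡⟨ *-assoc _ x y ⟩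
    x ⁻¹ * (x * y)   ≡⟨ cong (x ⁻¹ *_) xy≡xz ⟩
    x ⁻¹ * (x * z)   ≡⟨ *-assoc _ x z ⟨
    (x ⁻¹ * x) * z   ≡⟨ cong (_* z) (⁻¹-inverseˡ x≢0) ⟩
    1# * z           ≡⟨ *-identityˡ z ⟩
    z                ∎

  *-cancelʳ : ∀ {x y z} → x ≢ 0# → y * x ≡ z * x → y ≡ z
  *-cancelʳ {x} {y} {z} x≢0 yx≡zx = *-cancelˡ x≢0 (trans (*-comm x y) (trans yx≡zx (*-comm z x)))

  *-nonzero : ∀ {x y} → x ≢ 0# → y ≢ 0# → x * y ≢ 0#
  *-nonzero {x} {y} x≢0 y≢0 xy≡0 = y≢0 (*-cancelˡ x≢0 (trans xy≡0 (sym (zeroʳ x))))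

  zero-product : ∀ {x y} → x * y ≡ 0# → x ≡ 0# ⊎ y ≡ 0#
  zero-product {x} {y} xy≡0 with x ≟ 0# | y ≟ 0#
  ... | yes x≡0 | _       = inj₁ x≡0
  ... | no _    | yes y≡0 = inj₂ y≡0
  ... | no x≢0  | no y≢0  = contradiction xy≡0 (*-nonzero x≢0 y≢0)

  ⁻¹-nonzero : ∀ {x} → x ≢ 0# → x ⁻¹ ≢ 0#
  ⁻¹-nonzero {x} x≢0 x⁻¹≡0 =
    1#≢0# (trans (sym (⁻¹-inverse x x≢0)) (trans (cong (x *_) x⁻¹≡0) (zeroʳ x)))

  -‿nonzero : ∀ {x} → x ≢ 0# → - x ≢ 0#
  -‿nonzero {x} x≢0 -x≡0 = x≢0 (trans (sym (-‿involutive x)) (trans (cong -_ -x≡0) -0#≈0#))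

  ⁻¹-unique : ∀ {x y} → x * y ≡ 1# → y ≡ x ⁻¹
  ⁻¹-unique {x} {y} xy≡1 = *-cancelˡ x≢0 (trans xy≡1 (sym (⁻¹-inverse x x≢0)))
    where
    x≢0 : x ≢ 0#
    x≢0 x≡0 = 0≢1 (trans (sym (zeroˡ y)) (trans (cong (_* y) (sym x≡0)) xy≡1))

  ⁻¹-injective : ∀ {x y} → x ≢ 0# → y ≢ 0# → x ⁻¹ ≡ y ⁻¹ → x ≡ y
  ⁻¹-injective {x} {y} x≢0 y≢0 x⁻¹≡y⁻¹ = *-cancelʳ (⁻¹-nonzero y≢0) (begin
    x * y ⁻¹   ≡⟨ cong (x *_) x⁻¹≡y⁻¹ ⟨
    x * x ⁻¹   ≡⟨ ⁻¹-inverse x x≢0 ⟩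
    1#         ≡⟨ ⁻¹-inverse y y≢0 ⟨
    y * y ⁻¹   ∎)

  1#⁻¹≡1# : 1# ⁻¹ ≡ 1#
  1#⁻¹≡1# = sym (⁻¹-unique (*-identityˡ 1#))

  ^≡Exp-^ : ∀ x n → x ^ n ≡ x Exp.^ n
  ^≡Exp-^ x zero    = refl
  ^≡Exp-^ x (suc n) = cong (x *_) (^≡Exp-^ x n)

  ^-homo-* : ∀ x m n → x ^ (m ℕ.+ n) ≡ x ^ m * x ^ n
  ^-homo-* x m n = begin
    x ^ (m ℕ.+ n)            ≡⟨ ^≡Exp-^ x (m ℕ.+ n) ⟩
    x Exp.^ (m ℕ.+ n)        ≡⟨ Exp.^-homo-* x m n ⟩
    x Exp.^ m * x Exp.^ n    ≡⟨ cong₂ _*_ (^≡Exp-^ x m) (^≡Exp-^ x n) ⟨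
    x ^ m * x ^ n            ∎

  ^-assocʳ : ∀ x m n → (x ^ m) ^ n ≡ x ^ (m ℕ.* n)
  ^-assocʳ x m n = begin
    (x ^ m) ^ n              ≡⟨ ^≡Exp-^ (x ^ m) n ⟩
    (x ^ m) Exp.^ n          ≡⟨ cong (Exp._^ n) (^≡Exp-^ x m) ⟩
    (x Exp.^ m) Exp.^ n      ≡⟨ Exp.^-assocʳ x m n ⟩
    x Exp.^ (m ℕ.* n)        ≡⟨ ^≡Exp-^ x (m ℕ.* n) ⟨
    x ^ (m ℕ.* n)            ∎

  ^-distrib-* : ∀ x y n → (x * y) ^ n ≡ x ^ n * y ^ n
  ^-distrib-* x y n = begin
    (x * y) ^ n              ≡⟨ ^≡Exp-^ (x * y) n ⟩
    (x * y) Exp.^ n          ≡⟨ Exp.^-distrib-* x y n ⟩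
    x Exp.^ n * y Exp.^ n    ≡⟨ cong₂ _*_ (^≡Exp-^ x n) (^≡Exp-^ y n) ⟨
    x ^ n * y ^ n            ∎

  ^-comm : ∀ x m n → (x ^ m) ^ n ≡ (x ^ n) ^ m
  ^-comm x m n = trans (^-assocʳ x m n) (trans (cong (x ^_) (ℕ.*-comm m n)) (sym (^-assocʳ x n m)))

  1^n≡1 : ∀ n → 1# ^ n ≡ 1#
  1^n≡1 zero    = refl
  1^n≡1 (suc n) = trans (*-identityˡ _) (1^n≡1 n)

  ^≡1⇒^-*≡1 : ∀ {x} m → x ^ m ≡ 1# → ∀ j → x ^ (m ℕ.* j) ≡ 1#
  ^≡1⇒^-*≡1 {x} m x^m≡1 j = trans (sym (^-assocʳ x m j)) (trans (cong (_^ j) x^m≡1) (1^n≡1 j))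

  ^≡1⇒^∣≡1 : ∀ {x m n} → x ^ m ≡ 1# → m ∣ n → x ^ n ≡ 1#
  ^≡1⇒^∣≡1 {x} {m} x^m≡1 (divides j refl) =
    trans (cong (x ^_) (ℕ.*-comm j m)) (^≡1⇒^-*≡1 m x^m≡1 j)

  0^n≡0 : ∀ {n} → n ≢ 0 → 0# ^ n ≡ 0#
  0^n≡0 {zero}  n≢0 = contradiction refl n≢0
  0^n≡0 {suc n} _   = zeroˡ _

  ^-nonzero : ∀ {x} n → x ≢ 0# → x ^ n ≢ 0#
  ^-nonzero zero    x≢0 = 1#≢0#
  ^-nonzero (suc n) x≢0 = *-nonzero x≢0 (^-nonzero n x≢0)

  ^≡0⇒≡0 : ∀ {x} n → x ^ n ≡ 0# → x ≡ 0#
  ^≡0⇒≡0 {x} n x^n≡0 with x ≟ 0#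
  ... | yes x≡0 = x≡0
  ... | no x≢0  = contradiction x^n≡0 (^-nonzero n x≢0)

  ⁻¹-^ : ∀ {x} n → x ≢ 0# → (x ⁻¹) ^ n ≡ (x ^ n) ⁻¹
  ⁻¹-^ {x} n x≢0 = ⁻¹-unique (begin
    x ^ n * (x ⁻¹) ^ n   ≡⟨ ^-distrib-* x (x ⁻¹) n ⟨
    (x * x ⁻¹) ^ n       ≡⟨ cong (_^ n) (⁻¹-inverse x x≢0) ⟩
    1# ^ n               ≡⟨ 1^n≡1 n ⟩
    1#                   ∎)

  module Fold {_∙_ : Op₂ Carrier} {ε : Carrier} (isCM : IsCommutativeMonoid _≡_ _∙_ ε) where

    private
      M : CommutativeMonoid 0ℓ 0ℓ
      M = record { isCommutativeMonoid = isCM }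

    open Algebra.Properties.CommutativeMonoid.Sum M public
      using (sum; ∑-distrib-+; sum-cong-≗; sum-replicate)
    open Algebra.Properties.CommutativeMonoid.Sum M using (sum-remove; ∑-permute)
    open import Algebra.Properties.Monoid.Mult (CommutativeMonoid.monoid M) using (_×_)

    fold : (Carrier → Carrier) → Carrier
    fold f = sum (f ∘ from)

    fold-reindex : ∀ f {h h⁻} → (∀ x → h (h⁻ x) ≡ x) → (∀ x → h⁻ (h x) ≡ x) →
                   fold f ≡ fold (f ∘ h)
    fold-reindex f {h} {h⁻} hh⁻ h⁻h =
      trans (∑-permute (f ∘ from) π) (sum-cong-≗ {q} (λ i → cong f (strictlyInverseʳ _)))
      where
      π : Permutation q q
      π = permutation (λ i → to (h (from i))) (λ i → to (h⁻ (from i)))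
        (λ i → trans (cong (to ∘ h) (strictlyInverseʳ _)) (trans (cong to (hh⁻ _)) (strictlyInverseˡ i)))
        (λ i → trans (cong (to ∘ h⁻) (strictlyInverseʳ _)) (trans (cong to (h⁻h _)) (strictlyInverseˡ i)))

    sum-constant-except : ∀ {n} (t : Vector Carrier n) i {c} → (∀ j → j ≢ i → t j ≡ c) →
                          sum t ≡ t i ∙ ((n ℕ.∸ 1) × c)
    sum-constant-except {suc n} t i {c} t≡c =
      trans (sum-remove {i = i} t)
            (cong (t i ∙_) (trans (sum-cong-≗ {n} (λ j → t≡c _ (Fin.punchInᵢ≢i i j))) (sum-replicate n)))

  module ∑ = Fold (CommutativeRing.+-isCommutativeMonoid commutativeRing)
  module ∏ = Fold (CommutativeRing.*-isCommutativeMonoid commutativeRing)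

  open import Algebra.Properties.Semiring.Mult semiring public using (_×_; ×1-homo-*; ×-assoc-*)

  ×1-homo-^ : ∀ n k → (n ℕ.^ k) × 1# ≡ (n × 1#) ^ k
  ×1-homo-^ n zero    = +-identityʳ 1#
  ×1-homo-^ n (suc k) = trans (×1-homo-* n (n ℕ.^ k)) (cong ((n × 1#) *_) (×1-homo-^ n k))

  -- Translation by 1# permutes the field, so adding 1# to every element leaves the sum unchanged.
  characteristic : q × 1# ≡ 0#
  characteristic = +-cancelʳ (∑.fold id) (q × 1#) 0# (begin
    q × 1# + ∑.fold id              ≡⟨ cong (_+ ∑.fold id) (∑.sum-replicate q) ⟨
    ∑.fold (λ _ → 1#) + ∑.fold id   ≡⟨ ∑.∑-distrib-+ (λ _ → 1#) from ⟨
    ∑.fold (1# +_)                  ≡⟨ ∑.fold-reindex id {1# +_} {λ x → - 1# + x}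
                                            (+-Group.\\-leftDividesˡ 1#) (+-Group.\\-leftDividesʳ 1#) ⟨
    ∑.fold id                       ≡⟨ +-identityˡ _ ⟨
    0# + ∑.fold id                  ∎)

  ∏-nonzero : ∀ {n} (t : Vector Carrier n) → (∀ i → t i ≢ 0#) → ∏.sum t ≢ 0#
  ∏-nonzero {zero}  t t≢0 = 1#≢0#
  ∏-nonzero {suc n} t t≢0 = *-nonzero (t≢0 Fin.zero) (∏-nonzero (tail t) (t≢0 ∘ Fin.suc))

  -- Fermat's little theorem, by comparing the product of all y with that of all c * y,
  -- where 0# contributes the factor 1# to both.
  fermat : ∀ {c} → c ≢ 0# → c ^ (q ℕ.∸ 1) ≡ 1#
  fermat {c} c≢0 = sym (*-cancelʳ (∏-nonzero (φ ∘ from) (φ≢0 ∘ from)) (begin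
    1# * ∏.fold φ                ≡⟨ *-identityˡ _ ⟩
    ∏.fold φ                     ≡⟨ ∏.fold-reindex φ {c *_} {c ⁻¹ *_} c[c⁻¹x]≡x c⁻¹[cx]≡x ⟩
    ∏.fold (φ ∘ (c *_))          ≡⟨ ∏.sum-cong-≗ {q} (φ-scale ∘ from) ⟩
    ∏.fold (λ y → χ y * φ y)     ≡⟨ ∏.∑-distrib-+ (χ ∘ from) (φ ∘ from) ⟩
    ∏.fold χ * ∏.fold φ          ≡⟨ cong (_* ∏.fold φ) ∏χ≡c^[q-1] ⟩
    c ^ (q ℕ.∸ 1) * ∏.fold φ     ∎))
    where
    φ χ : Carrier → Carrier
    φ y with y ≟ 0#
    ... | yes _ = 1#
    ... | no _  = y
    χ y with y ≟ 0#
    ... | yes _ = 1#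
    ... | no _  = c

    φ≢0 : ∀ y → φ y ≢ 0#
    φ≢0 y with y ≟ 0#
    ... | yes _  = 1#≢0#
    ... | no y≢0 = y≢0

    φ-scale : ∀ y → φ (c * y) ≡ χ y * φ y
    φ-scale y with y ≟ 0# | c * y ≟ 0#
    ... | yes _   | yes _    = sym (*-identityˡ 1#)
    ... | yes y≡0 | no cy≢0  = contradiction (trans (cong (c *_) y≡0) (zeroʳ c)) cy≢0
    ... | no y≢0  | yes cy≡0 = contradiction cy≡0 (*-nonzero c≢0 y≢0)
    ... | no _    | no _     = refl

    χ≡c : ∀ i → i ≢ to 0# → χ (from i) ≡ c
    χ≡c i i≢0 with from i ≟ 0#
    ... | yes fi≡0 = contradiction (trans (sym (strictlyInverseˡ i)) (cong to fi≡0)) i≢0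
    ... | no _     = refl

    χ0≡1 : χ (from (to 0#)) ≡ 1#
    χ0≡1 rewrite strictlyInverseʳ 0# with 0# ≟ 0#
    ... | yes _   = refl
    ... | no 0≢0  = contradiction refl 0≢0

    ∏χ≡c^[q-1] : ∏.fold χ ≡ c ^ (q ℕ.∸ 1)
    ∏χ≡c^[q-1] = begin
      ∏.fold χ                         ≡⟨ ∏.sum-constant-except (χ ∘ from) (to 0#) χ≡c ⟩
      χ (from (to 0#)) * c Exp.^ (q ℕ.∸ 1) ≡⟨ cong₂ _*_ χ0≡1 (sym (^≡Exp-^ c (q ℕ.∸ 1))) ⟩
      1# * c ^ (q ℕ.∸ 1)               ≡⟨ *-identityˡ _ ⟩
      c ^ (q ℕ.∸ 1)                    ∎

    c[c⁻¹x]≡x : ∀ x → c * (c ⁻¹ * x) ≡ x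
    c[c⁻¹x]≡x x = trans (sym (*-assoc _ _ _)) (trans (cong (_* x) (⁻¹-inverse c c≢0)) (*-identityˡ x))
    c⁻¹[cx]≡x : ∀ x → c ⁻¹ * (c * x) ≡ x
    c⁻¹[cx]≡x x = trans (sym (*-assoc _ _ _)) (trans (cong (_* x) (⁻¹-inverseˡ c≢0)) (*-identityˡ x))

  ^-retraction : ∀ {e} → Coprime e (q ℕ.∸ 1) →
                 ∃[ root ] (∀ {x} → x ≢ 0# → root (x ^ e) ≡ x)
  ^-retraction {e} e⊥q-1 with coprime-Bézout e⊥q-1
  ... | Bézout.+- a b 1+b[q-1]≡ae = (_^ a) , λ {x} x≢0 → begin
    (x ^ e) ^ a                       ≡⟨ ^-assocʳ x e a ⟩
    x ^ (e ℕ.* a)                     ≡⟨ cong (x ^_) (trans (ℕ.*-comm e a) (sym 1+b[q-1]≡ae)) ⟩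
    x * x ^ (b ℕ.* (q ℕ.∸ 1))         ≡⟨ cong (λ n → x * x ^ n) (ℕ.*-comm b (q ℕ.∸ 1)) ⟩
    x * x ^ ((q ℕ.∸ 1) ℕ.* b)         ≡⟨ cong (x *_) (^≡1⇒^-*≡1 (q ℕ.∸ 1) (fermat x≢0) b) ⟩
    x * 1#                            ≡⟨ *-identityʳ x ⟩
    x                                 ∎
  ... | Bézout.-+ a b 1+ae≡b[q-1] = (λ y → (y ^ a) ⁻¹) , λ {x} x≢0 → sym (⁻¹-unique (begin
    (x ^ e) ^ a * x                   ≡⟨ *-comm _ x ⟩
    x * (x ^ e) ^ a                   ≡⟨ cong (x *_) (^-assocʳ x e a) ⟩
    x ^ suc (e ℕ.* a)                 ≡⟨ cong (λ n → x ^ suc n) (ℕ.*-comm e a) ⟩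
    x ^ suc (a ℕ.* e)                 ≡⟨ cong (x ^_) (trans 1+ae≡b[q-1] (ℕ.*-comm b (q ℕ.∸ 1))) ⟩
    x ^ ((q ℕ.∸ 1) ℕ.* b)             ≡⟨ ^≡1⇒^-*≡1 (q ℕ.∸ 1) (fermat x≢0) b ⟩
    1#                                ∎))

  ^-injective : ∀ {e} → Coprime (suc e) (q ℕ.∸ 1) → Injective _≡_ _≡_ (_^ suc e)
  ^-injective {e} e⊥q-1 {x} {y} x^e≡y^e with x ≟ 0# | y ≟ 0#
  ... | yes x≡0 | yes y≡0 = trans x≡0 (sym y≡0)
  ... | yes refl | no y≢0 = contradiction (^≡0⇒≡0 (suc e) (trans (sym x^e≡y^e) (zeroˡ _))) y≢0
  ... | no x≢0 | yes refl = contradiction (^≡0⇒≡0 (suc e) (trans x^e≡y^e (zeroˡ _))) x≢0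
  ... | no x≢0 | no y≢0 with root , root-^ ← ^-retraction e⊥q-1 =
    trans (sym (root-^ x≢0)) (trans (cong root x^e≡y^e) (root-^ y≢0))

  AdditivePower : ℕ → Set
  AdditivePower n = ∀ x y → (x + y) ^ n ≡ x ^ n + y ^ n

  additivePower-* : ∀ {m n} → AdditivePower m → AdditivePower n → AdditivePower (m ℕ.* n)
  additivePower-* {m} {n} add-m add-n x y = begin
    (x + y) ^ (m ℕ.* n)            ≡⟨ ^-assocʳ (x + y) m n ⟨
    ((x + y) ^ m) ^ n              ≡⟨ cong (_^ n) (add-m x y) ⟩
    (x ^ m + y ^ m) ^ n            ≡⟨ add-n (x ^ m) (y ^ m) ⟩
    (x ^ m) ^ n + (y ^ m) ^ n      ≡⟨ cong₂ _+_ (^-assocʳ x m n) (^-assocʳ y m n) ⟩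
    x ^ (m ℕ.* n) + y ^ (m ℕ.* n)  ∎

  additivePower-^ : ∀ {n} → AdditivePower n → ∀ k → AdditivePower (n ℕ.^ k)
  additivePower-^ add-n zero    x y = distribʳ 1# x y
  additivePower-^ {n} add-n (suc k) = additivePower-* {n} {n ℕ.^ k} add-n (additivePower-^ add-n k)

  additivePower-neg : ∀ n → AdditivePower (suc n) → ∀ x → (- x) ^ suc n ≡ - (x ^ suc n)
  additivePower-neg n add x = x+y≡0⇒x≡-y ((- x) ^ suc n) (x ^ suc n) (begin
    (- x) ^ suc n + x ^ suc n   ≡⟨ add (- x) x ⟨
    (- x + x) ^ suc n           ≡⟨ cong (_^ suc n) (-‿inverseˡ x) ⟩
    0# * 0# ^ n                 ≡⟨ zeroˡ _ ⟩
    0#                          ∎)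

  prod : ℕ → (ℕ → Carrier) → Carrier
  prod zero    f = 1#
  prod (suc n) f = f 0 * prod n (f ∘ suc)

  prod-cong : ∀ n {f g} → (∀ i → i ℕ.< n → f i ≡ g i) → prod n f ≡ prod n g
  prod-cong zero    f≡g = refl
  prod-cong (suc n) f≡g =
    cong₂ _*_ (f≡g 0 (ℕ.s≤s ℕ.z≤n)) (prod-cong n (λ i i<n → f≡g (suc i) (ℕ.s≤s i<n)))

  prod-+ : ∀ m n f → prod (m ℕ.+ n) f ≡ prod m f * prod n (λ j → f (m ℕ.+ j))
  prod-+ zero    n f = sym (*-identityˡ _)
  prod-+ (suc m) n f = trans (cong (f 0 *_) (prod-+ m n (f ∘ suc))) (sym (*-assoc _ _ _))

  prod-periodic : ∀ r f → (∀ j → f (r ℕ.+ j) ≡ f j) → ∀ s → prod (s ℕ.* r) f ≡ prod r f ^ s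
  prod-periodic r f f-periodic zero    = refl
  prod-periodic r f f-periodic (suc s) = begin
    prod (r ℕ.+ s ℕ.* r) f                          ≡⟨ prod-+ r (s ℕ.* r) f ⟩
    prod r f * prod (s ℕ.* r) (λ j → f (r ℕ.+ j))   ≡⟨ cong (prod r f *_) (prod-cong (s ℕ.* r) (λ j _ → f-periodic j)) ⟩
    prod r f * prod (s ℕ.* r) f                     ≡⟨ cong (prod r f *_) (prod-periodic r f f-periodic s) ⟩
    prod r f * prod r f ^ s                         ∎

  prod-scale : ∀ n c f → prod n (λ j → c * f j) ≡ c ^ n * prod n f
  prod-scale zero    c f = sym (*-identityˡ 1#)
  prod-scale (suc n) c f = begin
    (c * f 0) * prod n (λ j → c * f (suc j))   ≡⟨ cong ((c * f 0) *_) (prod-scale n c (f ∘ suc)) ⟩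
    (c * f 0) * (c ^ n * prod n (f ∘ suc))     ≡⟨ interchange c (f 0) (c ^ n) (prod n (f ∘ suc)) ⟩
    (c * c ^ n) * (f 0 * prod n (f ∘ suc))     ∎

  prod-^ : ∀ n f k → prod n f ^ k ≡ prod n (λ j → f j ^ k)
  prod-^ zero    f k = 1^n≡1 k
  prod-^ (suc n) f k = trans (^-distrib-* (f 0) _ k) (cong (f 0 ^ k *_) (prod-^ n (f ∘ suc) k))

  ^-geometric : ∀ Q i f → (∀ j → f j ^ Q ≡ f (suc j)) → f 0 ^ geometric Q i ≡ prod i f
  ^-geometric Q zero    f f^Q≡ = refl
  ^-geometric Q (suc i) f f^Q≡ = cong (f 0 *_) (begin
    f 0 ^ (Q ℕ.* g)             ≡⟨ cong (f 0 ^_) (ℕ.*-comm Q g) ⟩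
    f 0 ^ (g ℕ.* Q)             ≡⟨ ^-assocʳ (f 0) g Q ⟨
    (f 0 ^ g) ^ Q               ≡⟨ cong (_^ Q) (^-geometric Q i f f^Q≡) ⟩
    prod i f ^ Q                ≡⟨ prod-^ i f Q ⟩
    prod i (λ j → f j ^ Q)      ≡⟨ prod-cong i (λ j _ → f^Q≡ j) ⟩
    prod i (f ∘ suc)            ∎)
    where
    g = geometric Q i

  module _ {ω r} (ω^[1+r]≡1 : ω ^ suc r ≡ 1#) (ω^[1+j]≢1 : ∀ {j} → j ℕ.< r → ω ^ suc j ≢ 1#) where

    powers-distinct : ω ≢ 0# → ∀ {i j} → i ℕ.< j → j ℕ.< suc r → ω ^ i ≢ ω ^ j
    powers-distinct ω≢0 {i} i<j j<1+r ωⁱ≡ωʲ with d , refl ← ℕ.m≤n⇒∃[o]m+o≡n i<j =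
      ω^[1+j]≢1 d<r (*-cancelˡ (^-nonzero i ω≢0) (begin
        ω ^ i * ω ^ suc d     ≡⟨ ^-homo-* ω i (suc d) ⟨
        ω ^ (i ℕ.+ suc d)     ≡⟨ cong (ω ^_) (ℕ.+-suc i d) ⟩
        ω ^ suc (i ℕ.+ d)     ≡⟨ ωⁱ≡ωʲ ⟨
        ω ^ i                 ≡⟨ *-identityʳ _ ⟨
        ω ^ i * 1#            ∎))
      where
      d<r : d ℕ.< r
      d<r = ℕ.m+n≤o⇒n≤o i (subst (ℕ._≤ r) (sym (ℕ.+-suc i d)) (ℕ.≤-pred j<1+r))

    powers-injective : ω ≢ 0# → ∀ {i j} → i ℕ.< suc r → j ℕ.< suc r → ω ^ i ≡ ω ^ j → i ≡ j
    powers-injective ω≢0 {i} {j} i<1+r j<1+r ωⁱ≡ωʲ with ℕ.<-cmp i j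
    ... | tri≈ _ i≡j _ = i≡j
    ... | tri< i<j _ _ = contradiction ωⁱ≡ωʲ (powers-distinct ω≢0 i<j j<1+r)
    ... | tri> _ _ j<i = contradiction (sym ωⁱ≡ωʲ) (powers-distinct ω≢0 j<i i<1+r)

    order-divides : ∀ {n} → ω ^ n ≡ 1# → suc r ∣ n
    order-divides {n} ωⁿ≡1 = m%n≡0⇒n∣m n (suc r) (remainder≡0 (m%n<n n (suc r)) ω^t≡1)
      where
      t s : ℕ
      t = n ℕ.% suc r
      s = n ℕ./ suc r
      ω^t≡1 : ω ^ t ≡ 1#
      ω^t≡1 = begin
        ω ^ t                            ≡⟨ *-identityʳ _ ⟨
        ω ^ t * 1#                       ≡⟨ cong (ω ^ t *_) (^≡1⇒^-*≡1 (suc r) ω^[1+r]≡1 s) ⟨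
        ω ^ t * ω ^ (suc r ℕ.* s)        ≡⟨ ^-homo-* ω t (suc r ℕ.* s) ⟨
        ω ^ (t ℕ.+ suc r ℕ.* s)          ≡⟨ cong (λ k → ω ^ (t ℕ.+ k)) (ℕ.*-comm (suc r) s) ⟩
        ω ^ (t ℕ.+ s ℕ.* suc r)          ≡⟨ cong (ω ^_) (m≡m%n+[m/n]*n n (suc r)) ⟨
        ω ^ n                            ≡⟨ ωⁿ≡1 ⟩
        1#                               ∎
      remainder≡0 : ∀ {t} → t ℕ.< suc r → ω ^ t ≡ 1# → t ≡ 0
      remainder≡0 {zero}  _       _      = refl
      remainder≡0 {suc d} 1+d<1+r ω^t≡1 = contradiction ω^t≡1 (ω^[1+j]≢1 (ℕ.≤-pred 1+d<1+r))

module Frobenius {q p M : ℕ} (F : FiniteField q) (p-prime : Prime p) (q≡p^M : q ≡ p ℕ.^ M) where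

  open import Data.Nat as ℕ using (zero; suc; _<_; s≤s; z≤n)
  import Data.Nat.Properties as ℕ
  open import Data.Nat.Combinatorics using (_C_; nCn≡1)
  open import Data.Nat.Divisibility using (divides)
  open import Data.Fin as Fin using (Fin; toℕ; fromℕ; inject₁)
  import Data.Fin.Properties as Fin
  open import Data.Vec.Functional using (init)
  open import Relation.Binary.PropositionalEquality
  open import Relation.Nullary using (contradiction)
  open import Data.Nat.Primality using (¬prime[0])
  open Arithmetic using (prime∣C)
  open FiniteFieldProperties F
  open ≡-Reasoning
  open import Algebra.Properties.CommutativeSemiring.Exp commutativeSemiring using () renaming (_^_ to _^ᵉ_)
  open import Algebra.Properties.Semiring.Sum semiring using (sum; sum-init-last; sum-cong-≗; sum-replicate-zero)
  open import Algebra.Properties.CommutativeSemiring.Binomial commutativeSemiring using (theorem; binomialTerm)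

  p×1#≡0# : p × 1# ≡ 0#
  p×1#≡0# = ^≡0⇒≡0 M (begin
    (p × 1#) ^ M      ≡⟨ ×1-homo-^ p M ⟨
    (p ℕ.^ M) × 1#    ≡⟨ cong (_× 1#) q≡p^M ⟨
    q × 1#            ≡⟨ characteristic ⟩
    0#                ∎)

  ∣⇒×≡0# : ∀ {n} x → p ∣ n → n × x ≡ 0#
  ∣⇒×≡0# x (divides j refl) = begin
    (j ℕ.* p) × x                    ≡⟨ cong ((j ℕ.* p) ×_) (*-identityˡ x) ⟨
    (j ℕ.* p) × (1# * x)             ≡⟨ ×-assoc-* (j ℕ.* p) 1# x ⟨
    ((j ℕ.* p) × 1#) * x             ≡⟨ cong (_* x) (×1-homo-* j p) ⟩
    ((j × 1#) * (p × 1#)) * x        ≡⟨ cong (λ z → ((j × 1#) * z) * x) p×1#≡0# ⟩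
    ((j × 1#) * 0#) * x              ≡⟨ cong (_* x) (zeroʳ _) ⟩
    0# * x                           ≡⟨ zeroˡ x ⟩
    0#                               ∎

  frobenius : AdditivePower p
  frobenius = frobenius′ p refl
    where
    ^ᵉ≡^ : ∀ x n → x ^ᵉ n ≡ x ^ n
    ^ᵉ≡^ x n = sym (^≡Exp-^ x n)

    frobenius′ : ∀ n → n ≡ p → AdditivePower p
    frobenius′ zero      refl = contradiction p-prime ¬prime[0]
    frobenius′ (suc p′)  refl x y = begin
      (x + y) ^ p                                    ≡⟨ ^≡Exp-^ (x + y) p ⟩
      (x + y) ^ᵉ p                                   ≡⟨ theorem p x y ⟩
      T Fin.zero + sum (λ i → T (Fin.suc i))             ≡⟨ cong (T Fin.zero +_) (sum-init-last (λ i → T (Fin.suc i))) ⟩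
      T Fin.zero + (sum (init (λ i → T (Fin.suc i))) + T (fromℕ p))
        ≡⟨ cong (λ s → T Fin.zero + (s + T (fromℕ p))) middle≡0 ⟩
      T Fin.zero + (0# + T (fromℕ p))                     ≡⟨ cong₂ (λ a b → a + b) first (trans (+-identityˡ _) last) ⟩
      y ^ p + x ^ p                                  ≡⟨ +-comm _ _ ⟩
      x ^ p + y ^ p                                  ∎
      where
      T = binomialTerm x y p
      middle≡0 : sum (init (λ i → T (Fin.suc i))) ≡ 0#
      middle≡0 = trans (sum-cong-≗ {p′} (λ i → ∣⇒×≡0# _ (prime∣C p-prime (s≤s z≤n) (i<p i))))
                       (sum-replicate-zero p′)
        where
        i<p : ∀ (i : Fin p′) → suc (toℕ (inject₁ i)) < p
        i<p i = s≤s (subst (_< p′) (sym (Fin.toℕ-inject₁ i)) (Fin.toℕ<n i))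
      first : T Fin.zero ≡ y ^ p
      first = trans (+-identityʳ _) (trans (*-identityˡ _) (^ᵉ≡^ y p))
      last : T (fromℕ p) ≡ x ^ p
      last = begin
        T (fromℕ p)                             ≡⟨ cong (λ k → (p C k) × (x ^ᵉ k * y ^ᵉ (p ℕ.∸ k))) (Fin.toℕ-fromℕ p) ⟩
        (p C p) × (x ^ᵉ p * y ^ᵉ (p ℕ.∸ p))     ≡⟨ cong₂ (λ c k → c × (x ^ᵉ p * y ^ᵉ k)) (nCn≡1 p) (ℕ.n∸n≡0 p) ⟩
        1 × (x ^ᵉ p * 1#)                       ≡⟨ +-identityʳ _ ⟩
        x ^ᵉ p * 1#                             ≡⟨ *-identityʳ _ ⟩
        x ^ᵉ p                                  ≡⟨ ^ᵉ≡^ x p ⟩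
        x ^ p                                   ∎

module Polynomial {q : ℕ} (F : FiniteField q) where

  open import Data.Nat as ℕ using (zero; suc; _<_; s≤s; z≤n)
  import Data.Nat.Properties as ℕ
  open import Data.List using (List; []; _∷_; length; replicate)
  open import Data.List.Properties using (length-replicate)
  open import Data.Sum using (inj₁; inj₂)
  open import Function.Base using (_∘_)
  open import Relation.Nullary using (contradiction)
  open import Relation.Binary.PropositionalEquality
  open FiniteFieldProperties F
  open ≡-Reasoning
  open import Algebra.Solver.Ring.NaturalCoefficients.Default commutativeSemiring

  -- eval [c₀, …, cₙ₋₁] is the monic polynomial xⁿ + cₙ₋₁xⁿ⁻¹ + … + c₀, in Horner form.
  eval : List Carrier → Carrier → Carrier
  eval []       x = 1#
  eval (c ∷ cs) x = eval cs x * x + c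

  quotient : Carrier → List Carrier → List Carrier
  quotient α []                = []
  quotient α (c ∷ [])          = []
  quotient α (c ∷ cs@(_ ∷ _))  = eval cs α ∷ quotient α cs

  length-quotient : ∀ α c cs → length (quotient α (c ∷ cs)) ≡ length cs
  length-quotient α c []       = refl
  length-quotient α c (d ∷ ds) = cong suc (length-quotient α d ds)

  remainder-theorem : ∀ α c cs x →
             eval (c ∷ cs) x ≡ eval (quotient α (c ∷ cs)) x * (x + - α) + eval (c ∷ cs) α
  remainder-theorem α c [] x = begin
    1# * x + c                        ≡⟨ cong (λ z → 1# * z + c) ([x-y]+y≡x x α) ⟨
    1# * ((x + - α) + α) + c          ≡⟨ solve 4 (λ t a c o → o :* (t :+ a) :+ c := o :* t :+ (o :* a :+ c))
                                                 refl (x + - α) α c 1# ⟩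
    1# * (x + - α) + (1# * α + c)     ∎
  remainder-theorem α c (d ∷ ds) x = begin
    eval (d ∷ ds) x * x + c              ≡⟨ cong (λ z → z * x + c) (remainder-theorem α d ds x) ⟩
    (D * t + e) * x + c                  ≡⟨ cong (λ z → (D * t + e) * z + c) ([x-y]+y≡x x α) ⟨
    (D * t + e) * (t + α) + c            ≡⟨ solve 5 (λ D t e a c → (D :* t :+ e) :* (t :+ a) :+ c
                                                     := (D :* (t :+ a) :+ e) :* t :+ (e :* a :+ c))
                                                refl D t e α c ⟩
    (D * (t + α) + e) * t + (e * α + c)  ≡⟨ cong (λ z → (D * z + e) * t + (e * α + c)) ([x-y]+y≡x x α) ⟩
    (D * x + e) * t + (e * α + c)        ∎
    where
    D = eval (quotient α (d ∷ ds)) x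
    e = eval (d ∷ ds) α
    t = x + - α

  monic-factorisation : ∀ r (cs : List Carrier) → length cs ≡ r → (α : ℕ → Carrier) →
                        (∀ {i j} → i < r → j < r → α i ≡ α j → i ≡ j) →
                        (∀ {i} → i < r → eval cs (α i) ≡ 0#) →
                        ∀ x → eval cs x ≡ prod r (λ i → x + - α i)
  monic-factorisation zero    []       refl α α-inj roots x = refl
  monic-factorisation (suc r) (c ∷ cs) |cs|≡ α α-inj roots x = begin
    eval (c ∷ cs) x                              ≡⟨ remainder-theorem (α 0) c cs x ⟩
    eval Q x * (x + - α 0) + eval (c ∷ cs) (α 0) ≡⟨ cong (eval Q x * (x + - α 0) +_) (roots 0<1+r) ⟩
    eval Q x * (x + - α 0) + 0#                  ≡⟨ +-identityʳ _ ⟩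
    eval Q x * (x + - α 0)                       ≡⟨ *-comm _ _ ⟩
    (x + - α 0) * eval Q x                       ≡⟨ cong ((x + - α 0) *_) (monic-factorisation r Q |Q|≡r
                                                      (α ∘ suc) α-inj′ Q-roots x) ⟩
    (x + - α 0) * prod r (λ i → x + - α (suc i)) ∎
    where
    Q = quotient (α 0) (c ∷ cs)
    0<1+r = s≤s z≤n
    |Q|≡r : length Q ≡ r
    |Q|≡r = trans (length-quotient (α 0) c cs) (ℕ.suc-injective |cs|≡)
    α-inj′ : ∀ {i j} → i < r → j < r → α (suc i) ≡ α (suc j) → i ≡ j
    α-inj′ i<r j<r αi≡αj = ℕ.suc-injective (α-inj (s≤s i<r) (s≤s j<r) αi≡αj)
    Q-roots : ∀ {i} → i < r → eval Q (α (suc i)) ≡ 0#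
    Q-roots {i} i<r with zero-product Q[αᵢ]*[αᵢ-α₀]≡0
      where
      Q[αᵢ]*[αᵢ-α₀]≡0 : eval Q (α (suc i)) * (α (suc i) + - α 0) ≡ 0#
      Q[αᵢ]*[αᵢ-α₀]≡0 = begin
        eval Q (α (suc i)) * (α (suc i) + - α 0)                        ≡⟨ +-identityʳ _ ⟨
        eval Q (α (suc i)) * (α (suc i) + - α 0) + 0#                   ≡⟨ cong (eval Q (α (suc i)) * (α (suc i) + - α 0) +_) (roots 0<1+r) ⟨
        eval Q (α (suc i)) * (α (suc i) + - α 0) + eval (c ∷ cs) (α 0)  ≡⟨ remainder-theorem (α 0) c cs (α (suc i)) ⟨
        eval (c ∷ cs) (α (suc i))                                       ≡⟨ roots (s≤s i<r) ⟩
        0#                                                              ∎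
    ... | inj₁ Q[αᵢ]≡0   = Q[αᵢ]≡0
    ... | inj₂ αᵢ-α₀≡0 = contradiction (α-inj (s≤s i<r) 0<1+r (x-y≡0⇒x≡y _ _ αᵢ-α₀≡0)) λ ()

  roots-of-unity-factorisation : ∀ r {ζ} → ζ ^ suc r ≡ 1# →
                                 (∀ {i j} → i < suc r → j < suc r → ζ ^ i ≡ ζ ^ j → i ≡ j) →
                                 ∀ x → prod (suc r) (λ i → x + - (ζ ^ i)) ≡ x ^ suc r + - 1#
  roots-of-unity-factorisation r {ζ} ζ^r≡1 ζ^-inj x = begin
    prod (suc r) (λ i → x + - (ζ ^ i))  ≡⟨ monic-factorisation (suc r) cs (cong suc (length-replicate r)) (ζ ^_) ζ^-inj
                                             (λ {i} _ → ζ^i-root i) x ⟨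
    eval cs x                           ≡⟨ eval-cs x ⟩
    x ^ suc r + - 1#                    ∎
    where
    cs = - 1# ∷ replicate r 0#
    eval-zeros : ∀ n y → eval (replicate n 0#) y ≡ y ^ n
    eval-zeros zero    y = refl
    eval-zeros (suc n) y = trans (+-identityʳ _) (trans (cong (_* y) (eval-zeros n y)) (*-comm _ y))
    eval-cs : ∀ y → eval cs y ≡ y ^ suc r + - 1#
    eval-cs y = cong (_+ - 1#) (trans (cong (_* y) (eval-zeros r y)) (*-comm _ y))
    ζ^i-root : ∀ i → eval cs (ζ ^ i) ≡ 0#
    ζ^i-root i = begin
      eval cs (ζ ^ i)                 ≡⟨ eval-cs (ζ ^ i) ⟩
      (ζ ^ i) ^ suc r + - 1#          ≡⟨ cong (_+ - 1#) (trans (^-comm ζ i (suc r)) (trans (cong (_^ i) ζ^r≡1) (1^n≡1 i))) ⟩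
      1# + - 1#                       ≡⟨ -‿inverseʳ 1# ⟩
      0#                              ∎

module CompletePermutation {p k : ℕ} (p-prime : Prime p) (k≥1 : 1 ≤ k)
                           (F : FiniteField (p ℕ.^ ((p ∸ 1) ℕ.* k))) where

  open import Data.Nat as ℕ using (suc; _<_)
  import Data.Nat.Properties as ℕ
  open import Data.Nat.Divisibility using (divides; ∣-trans; module _∣_)
  open import Data.Nat.Primality using (¬prime[0]; ¬prime[1])
  open import Data.Nat.Coprimality using (Coprime)
  open import Data.Nat.DivMod using (m*n/n≡m)
  open import Data.Product using (_,_; proj₁; proj₂)
  open import Function.Base using (_∘_)
  open import Function.Definitions using (Injective)
  open import Relation.Nullary using (yes; no; contradiction)
  open import Relation.Binary.PropositionalEquality
  open Arithmetic
  open FiniteFieldProperties F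
  open Polynomial F using (roots-of-unity-factorisation)
  open ≡-Reasoning
  open import Algebra.Solver.Ring.NaturalCoefficients.Default commutativeSemiring

  m R S : ℕ
  m = p ∸ 1
  R = p ℕ.^ k ∸ 1
  S = geometric (suc R) m

  p≢0 : p ≢ 0
  p≢0 refl = ¬prime[0] p-prime

  m≢0 : m ≢ 0
  m≢0 m≡0 = ¬prime[1] (subst Prime (trans (sym (suc[n∸1]≡n p≢0)) (cong suc m≡0)) p-prime)

  1+m≡p : suc m ≡ p
  1+m≡p = suc[n∸1]≡n p≢0

  1+R≡p^k : suc R ≡ p ℕ.^ k
  1+R≡p^k = suc[n∸1]≡n (p≢0 ∘ ℕ.m^n≡0⇒m≡0 p k)

  q≡1+SR : p ℕ.^ (m ℕ.* k) ≡ suc (S ℕ.* R)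
  q≡1+SR = begin
    p ℕ.^ (m ℕ.* k)      ≡⟨ cong (p ℕ.^_) (ℕ.*-comm m k) ⟩
    p ℕ.^ (k ℕ.* m)      ≡⟨ ℕ.^-*-assoc p k m ⟨
    (p ℕ.^ k) ℕ.^ m      ≡⟨ cong (ℕ._^ m) 1+R≡p^k ⟨
    suc R ℕ.^ m          ≡⟨ geometric-pow R m ⟨
    suc (R ℕ.* S)        ≡⟨ cong suc (ℕ.*-comm R S) ⟩
    suc (S ℕ.* R)        ∎

  m∣R : m ∣ R
  m∣R = divides (geometric p k) (ℕ.suc-injective (begin
    suc R                            ≡⟨ 1+R≡p^k ⟩
    p ℕ.^ k                          ≡⟨ cong (ℕ._^ k) 1+m≡p ⟨
    suc m ℕ.^ k                      ≡⟨ geometric-pow m k ⟨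
    suc (m ℕ.* geometric (suc m) k)  ≡⟨ cong (λ n → suc (m ℕ.* geometric n k)) 1+m≡p ⟩
    suc (m ℕ.* geometric p k)        ≡⟨ cong suc (ℕ.*-comm m _) ⟩
    suc (geometric p k ℕ.* m)        ∎))

  1+S⊥q-1 : Coprime (suc S) (p ℕ.^ (m ℕ.* k) ∸ 1)
  1+S⊥q-1 with h , S≡m+Rh ← geometric-mod R m =
    subst (Coprime (suc S)) (cong (_∸ 1) (sym q≡1+SR)) (coprime-* (coprime-suc S) 1+S⊥R)
    where
    1+S⊥R : Coprime (suc S) R
    1+S⊥R = subst (λ n → Coprime n R) (trans (cong (ℕ._+ R ℕ.* h) (sym 1+m≡p)) (cong suc (sym S≡m+Rh)))
                  (coprime-+* h (coprime-pred-pow k≥1 1+R≡p^k))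

  open Frobenius {M = m ℕ.* k} F p-prime refl using (frobenius)

  frobenius-Q : AdditivePower (suc R)
  frobenius-Q = subst AdditivePower (sym 1+R≡p^k) (additivePower-^ frobenius k)

  frobenius-p : AdditivePower (suc m)
  frobenius-p = subst AdditivePower (sym 1+m≡p) frobenius

  InSubfield : Carrier → Set
  InSubfield x = x ^ suc R ≡ x

  ^R≡1⇒subfield : ∀ {x} → x ^ R ≡ 1# → InSubfield x
  ^R≡1⇒subfield {x} x^R≡1 = trans (cong (x *_) x^R≡1) (*-identityʳ x)

  subfield⇒^R≡1 : ∀ {x} → InSubfield x → x ≢ 0# → x ^ R ≡ 1#
  subfield⇒^R≡1 {x} x∈K x≢0 = *-cancelˡ x≢0 (trans x∈K (sym (*-identityʳ x)))

  subfield-* : ∀ {x y} → InSubfield x → InSubfield y → InSubfield (x * y)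
  subfield-* {x} {y} x∈K y∈K = trans (^-distrib-* x y (suc R)) (cong₂ _*_ x∈K y∈K)

  subfield-+ : ∀ {x y} → InSubfield x → InSubfield y → InSubfield (x + y)
  subfield-+ {x} {y} x∈K y∈K = trans (frobenius-Q x y) (cong₂ _+_ x∈K y∈K)

  subfield-neg : ∀ {x} → InSubfield x → InSubfield (- x)
  subfield-neg {x} x∈K = trans (additivePower-neg R frobenius-Q x) (cong -_ x∈K)

  subfield-^ : ∀ {x} n → InSubfield x → InSubfield (x ^ n)
  subfield-^ {x} n x∈K = trans (^-comm x n (suc R)) (cong (_^ n) x∈K)

  subfield-⁻¹ : ∀ {x} → InSubfield x → InSubfield (x ⁻¹)
  subfield-⁻¹ {x} x∈K with x ≟ 0#
  ... | yes refl = trans (cong (_^ suc R) ⁻¹-zero) (trans (zeroˡ _) (sym ⁻¹-zero))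
  ... | no x≢0   = trans (⁻¹-^ (suc R) x≢0) (cong _⁻¹ x∈K)

  norm-subfield : ∀ {x} → x ≢ 0# → InSubfield (x ^ S)
  norm-subfield {x} x≢0 = ^R≡1⇒subfield (begin
    (x ^ S) ^ R       ≡⟨ ^-assocʳ x S R ⟩
    x ^ (S ℕ.* R)     ≡⟨ cong (λ n → x ^ (n ∸ 1)) q≡1+SR ⟨
    x ^ (q ∸ 1)       ≡⟨ fermat x≢0 ⟩
    1#                ∎)
    where q = p ℕ.^ (m ℕ.* k)

  module _ {a : Carrier} (ω^m≡1 : (a ^ R) ^ m ≡ 1#) (ω≢1 : a ^ R ≢ 1#) where

    ω : Carrier
    ω = a ^ R

    ω≢0 : ω ≢ 0#
    ω≢0 ω≡0 = 0≢1 (trans (sym (0^n≡0 m≢0)) (trans (cong (_^ m) (sym ω≡0)) ω^m≡1))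

    a≢0 : a ≢ 0#
    a≢0 a≡0 with R ℕ.≟ 0
    ... | yes R≡0 = ω≢1 (cong (a ^_) R≡0)
    ... | no R≢0  = ω≢0 (trans (cong (_^ R) a≡0) (0^n≡0 R≢0))

    ω-subfield : InSubfield ω
    ω-subfield = ^R≡1⇒subfield (^≡1⇒^∣≡1 ω^m≡1 m∣R)

    order : Minimal (λ i → ω ^ suc i ≟ 1#)
    order = minimal (λ i → ω ^ suc i ≟ 1#) {m ∸ 1} (subst (λ n → ω ^ n ≡ 1#) (sym (suc[n∸1]≡n m≢0)) ω^m≡1)

    r : ℕ
    r = suc (proj₁ order)

    ω^r≡1 : ω ^ r ≡ 1#
    ω^r≡1 = proj₁ (proj₂ order)

    ω^[1+j]≢1 : ∀ {j} → j < proj₁ order → ω ^ suc j ≢ 1#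
    ω^[1+j]≢1 = proj₂ (proj₂ order)

    r∣m : r ∣ m
    r∣m = order-divides ω^r≡1 ω^[1+j]≢1 ω^m≡1

    ω^-injective : ∀ {i j} → i < r → j < r → ω ^ i ≡ ω ^ j → i ≡ j
    ω^-injective = powers-injective ω^r≡1 ω^[1+j]≢1 ω≢0

    s : ℕ
    s = _∣_.quotient r∣m

    m≡s*r : m ≡ s ℕ.* r
    m≡s*r = _∣_.equality r∣m

    b c : Carrier
    b = - a
    c = b ^ r

    b≢0 : b ≢ 0#
    b≢0 = -‿nonzero a≢0

    b^R≡ω : b ^ R ≡ ω
    b^R≡ω = *-cancelˡ b≢0 (begin
      (- a) ^ suc R       ≡⟨ additivePower-neg R frobenius-Q a ⟩
      - (a * ω)           ≡⟨ -‿distribˡ-* a ω ⟩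
      b * ω               ∎)

    c≢0 : c ≢ 0#
    c≢0 = ^-nonzero r b≢0

    c-subfield : InSubfield c
    c-subfield = ^R≡1⇒subfield (trans (^-comm b r R) (trans (cong (_^ r) b^R≡ω) ω^r≡1))

    -- A root e of x ^ r = c in the subfield would make b / e an r-th root of unity,
    -- but (b / e) ^ R = ω ≢ 1 although r ∣ R.
    c-not-rth-power : ∀ {e} → InSubfield e → e ≢ 0# → e ^ r ≢ c
    c-not-rth-power {e} e∈K e≢0 e^r≡c = ω≢1 (begin
      ω                ≡⟨ t^R≡ω ⟨
      t ^ R            ≡⟨ ^≡1⇒^∣≡1 t^r≡1 (∣-trans r∣m m∣R) ⟩
      1#               ∎)
      where
      t = b * e ⁻¹
      t^r≡1 : t ^ r ≡ 1#
      t^r≡1 = begin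
        t ^ r                ≡⟨ ^-distrib-* b (e ⁻¹) r ⟩
        c * (e ⁻¹) ^ r       ≡⟨ cong (c *_) (⁻¹-^ r e≢0) ⟩
        c * (e ^ r) ⁻¹       ≡⟨ cong (λ z → c * z ⁻¹) e^r≡c ⟩
        c * c ⁻¹             ≡⟨ ⁻¹-inverse c c≢0 ⟩
        1#                   ∎
      t^R≡ω : t ^ R ≡ ω
      t^R≡ω = begin
        t ^ R                ≡⟨ ^-distrib-* b (e ⁻¹) R ⟩
        b ^ R * (e ⁻¹) ^ R   ≡⟨ cong₂ _*_ b^R≡ω (⁻¹-^ R e≢0) ⟩
        ω * (e ^ R) ⁻¹       ≡⟨ cong (λ z → ω * z ⁻¹) (subfield⇒^R≡1 e∈K e≢0) ⟩
        ω * 1# ⁻¹            ≡⟨ cong (ω *_) 1#⁻¹≡1# ⟩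
        ω * 1#               ≡⟨ *-identityʳ ω ⟩
        ω                    ∎

    conjugate : ∀ {u} → InSubfield u → ∀ j → (u + a * ω ^ j) ^ suc R ≡ u + a * ω ^ suc j
    conjugate {u} u∈K j = begin
      (u + a * ω ^ j) ^ suc R               ≡⟨ frobenius-Q u (a * ω ^ j) ⟩
      u ^ suc R + (a * ω ^ j) ^ suc R       ≡⟨ cong₂ _+_ u∈K (^-distrib-* a (ω ^ j) (suc R)) ⟩
      u + (a * ω) * (ω ^ j) ^ suc R         ≡⟨ cong (λ z → u + (a * ω) * z) (subfield-^ j ω-subfield) ⟩
      u + (a * ω) * ω ^ j                   ≡⟨ cong (u +_) (*-assoc a ω (ω ^ j)) ⟩
      u + a * ω ^ suc j                     ∎

    norm-translate : ∀ {u} → InSubfield u → (u + a) ^ S ≡ prod m (λ j → u + a * ω ^ j)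
    norm-translate {u} u∈K =
      trans (cong (λ z → (u + z) ^ S) (sym (*-identityʳ a))) (^-geometric (suc R) m _ (conjugate u∈K))

    D : Carrier → Carrier
    D u = u ^ r + - c

    prod-translates : ∀ u → prod r (λ j → u + a * ω ^ j) ≡ D u
    prod-translates u = begin
      prod r (λ j → u + a * ω ^ j)            ≡⟨ prod-cong r (λ j _ → translate≡ j) ⟩
      prod r (λ j → b * (x + - (ω ^ j)))      ≡⟨ prod-scale r b (λ j → x + - (ω ^ j)) ⟩
      c * prod r (λ j → x + - (ω ^ j))        ≡⟨ cong (c *_) (roots-of-unity-factorisation _ ω^r≡1 ω^-injective x) ⟩
      c * (x ^ r + - 1#)                      ≡⟨ distribˡ c (x ^ r) (- 1#) ⟩
      c * x ^ r + c * - 1#                    ≡⟨ cong₂ _+_ (^-distrib-* b x r) (-‿distribʳ-* c 1#) ⟨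
      (b * x) ^ r + - (c * 1#)                ≡⟨ cong₂ (λ y z → y ^ r + - z) bx≡u (*-identityʳ c) ⟩
      u ^ r + - c                             ∎
      where
      x = u * b ⁻¹
      bx≡u : b * x ≡ u
      bx≡u = trans (*-comm b x) (trans (*-assoc u _ b) (trans (cong (u *_) (⁻¹-inverseˡ b≢0)) (*-identityʳ u)))
      translate≡ : ∀ j → u + a * ω ^ j ≡ b * (x + - (ω ^ j))
      translate≡ j = sym (begin
        b * (x + - (ω ^ j))      ≡⟨ distribˡ b x (- (ω ^ j)) ⟩
        b * x + b * - (ω ^ j)    ≡⟨ cong₂ _+_ bx≡u (sym (-‿distribʳ-* b (ω ^ j))) ⟩
        u + - (b * ω ^ j)        ≡⟨ cong (λ z → u + - z) (-‿distribˡ-* a (ω ^ j)) ⟨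
        u + - (- (a * ω ^ j))    ≡⟨ cong (u +_) (-‿involutive _) ⟩
        u + a * ω ^ j            ∎)

    Φ : Carrier → Carrier
    Φ u = u * (u + a) ^ S

    Φ≡ : ∀ {u} → InSubfield u → Φ u ≡ u * D u ^ s
    Φ≡ {u} u∈K = cong (u *_) (begin
      (u + a) ^ S                              ≡⟨ norm-translate u∈K ⟩
      prod m (λ j → u + a * ω ^ j)             ≡⟨ cong (λ n → prod n (λ j → u + a * ω ^ j)) m≡s*r ⟩
      prod (s ℕ.* r) (λ j → u + a * ω ^ j)     ≡⟨ prod-periodic r _ ω-periodic s ⟩
      prod r (λ j → u + a * ω ^ j) ^ s         ≡⟨ cong (_^ s) (prod-translates u) ⟩
      D u ^ s                                  ∎)
      where
      ω-periodic : ∀ j → u + a * ω ^ (r ℕ.+ j) ≡ u + a * ω ^ j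
      ω-periodic j = cong (λ z → u + a * z)
        (trans (^-homo-* ω r j) (trans (cong (_* ω ^ j) ω^r≡1) (*-identityˡ _)))

    D≢0 : ∀ {u} → InSubfield u → u ≢ 0# → D u ≢ 0#
    D≢0 u∈K u≢0 Du≡0 = c-not-rth-power u∈K u≢0 (x-y≡0⇒x≡y _ _ Du≡0)

    D-subfield : ∀ {u} → InSubfield u → InSubfield (D u)
    D-subfield u∈K = subfield-+ (subfield-^ r u∈K) (subfield-neg c-subfield)

    Φ^r≡ : ∀ {u} → InSubfield u → Φ u ^ r ≡ u ^ r * D u ^ m
    Φ^r≡ {u} u∈K = begin
      Φ u ^ r                   ≡⟨ cong (_^ r) (Φ≡ u∈K) ⟩
      (u * D u ^ s) ^ r         ≡⟨ ^-distrib-* u _ r ⟩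
      u ^ r * (D u ^ s) ^ r     ≡⟨ cong (u ^ r *_) (^-assocʳ (D u) s r) ⟩
      u ^ r * D u ^ (s ℕ.* r)   ≡⟨ cong (λ n → u ^ r * D u ^ n) m≡s*r ⟨
      u ^ r * D u ^ m           ∎

    w : Carrier → Carrier
    w u = c * D u ⁻¹

    w-equation : ∀ {u} → InSubfield u → u ≢ 0# → Φ u ^ r * w u ^ suc m ≡ c ^ suc m * (w u + 1#)
    w-equation {u} u∈K u≢0 = begin
      Φ u ^ r * w u ^ suc m                                 ≡⟨ cong₂ _*_ (Φ^r≡ u∈K) (^-distrib-* c (Du ⁻¹) (suc m)) ⟩
      (u ^ r * Du ^ m) * (c ^ suc m * (Du ⁻¹ * (Du ⁻¹) ^ m)) ≡⟨ solve 5 (λ U Dᵐ Cᵖ D⁻¹ D⁻ᵐ → (U :* Dᵐ) :* (Cᵖ :* (D⁻¹ :* D⁻ᵐ))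
                                                                     := (Cᵖ :* (U :* D⁻¹)) :* (Dᵐ :* D⁻ᵐ))
                                                                refl (u ^ r) (Du ^ m) (c ^ suc m) (Du ⁻¹) ((Du ⁻¹) ^ m) ⟩
      (c ^ suc m * (u ^ r * Du ⁻¹)) * (Du ^ m * (Du ⁻¹) ^ m) ≡⟨ cong (c ^ suc m * (u ^ r * Du ⁻¹) *_) Dᵐ*D⁻ᵐ≡1 ⟩
      (c ^ suc m * (u ^ r * Du ⁻¹)) * 1#                     ≡⟨ *-identityʳ _ ⟩
      c ^ suc m * (u ^ r * Du ⁻¹)                            ≡⟨ cong (λ z → c ^ suc m * (z * Du ⁻¹)) u^r≡c+D ⟩
      c ^ suc m * ((c + Du) * Du ⁻¹)                         ≡⟨ cong (c ^ suc m *_) (distribʳ (Du ⁻¹) c Du) ⟩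
      c ^ suc m * (w u + Du * Du ⁻¹)                         ≡⟨ cong (λ z → c ^ suc m * (w u + z)) (⁻¹-inverse Du Du≢0) ⟩
      c ^ suc m * (w u + 1#)                                 ∎
      where
      Du = D u
      Du≢0 = D≢0 u∈K u≢0
      Dᵐ*D⁻ᵐ≡1 : Du ^ m * (Du ⁻¹) ^ m ≡ 1#
      Dᵐ*D⁻ᵐ≡1 = trans (sym (^-distrib-* Du (Du ⁻¹) m)) (trans (cong (_^ m) (⁻¹-inverse Du Du≢0)) (1^n≡1 m))
      u^r≡c+D : u ^ r ≡ c + Du
      u^r≡c+D = sym (trans (+-comm c Du) ([x-y]+y≡x (u ^ r) c))

    -- X ↦ X ^ p is additive.
    root-difference : ∀ {T x y} → T * x ^ suc m ≡ c ^ suc m * (x + 1#) → T * y ^ suc m ≡ c ^ suc m * (y + 1#) →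
                      T * (x + - y) ^ suc m ≡ c ^ suc m * (x + - y)
    root-difference {T} {x} {y} x-root y-root = +-cancelʳ (T * y ^ suc m) _ _ (begin
      T * δ ^ suc m + T * y ^ suc m      ≡⟨ distribˡ T (δ ^ suc m) (y ^ suc m) ⟨
      T * (δ ^ suc m + y ^ suc m)        ≡⟨ cong (T *_) (frobenius-p δ y) ⟨
      T * (δ + y) ^ suc m                ≡⟨ cong (λ z → T * z ^ suc m) ([x-y]+y≡x x y) ⟩
      T * x ^ suc m                      ≡⟨ x-root ⟩
      c ^ suc m * (x + 1#)               ≡⟨ cong (λ z → c ^ suc m * (z + 1#)) ([x-y]+y≡x x y) ⟨
      c ^ suc m * ((δ + y) + 1#)         ≡⟨ solve 3 (λ C d y → C :* ((d :+ y) :+ con 1) := C :* d :+ C :* (y :+ con 1))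
                                                  refl (c ^ suc m) δ y ⟩
      c ^ suc m * δ + c ^ suc m * (y + 1#) ≡⟨ cong (c ^ suc m * δ +_) y-root ⟨
      c ^ suc m * δ + T * y ^ suc m      ∎)
      where
      δ = x + - y

    -- Otherwise u * (D u * δ) ^ s / c ^ s would be an r-th root of c in the subfield.
    no-subfield-root : ∀ {u δ} → InSubfield u → u ≢ 0# → InSubfield δ → δ ≢ 0# →
                       Φ u ^ r * δ ^ m ≢ c ^ suc m
    no-subfield-root {u} {δ} u∈K u≢0 δ∈K δ≢0 Tδᵐ≡cᵖ = c-not-rth-power e∈K e≢0 (begin
      e ^ r                            ≡⟨ ^-distrib-* G (cˢ ⁻¹) r ⟩
      G ^ r * (cˢ ⁻¹) ^ r              ≡⟨ cong₂ _*_ G^r≡ (⁻¹-^ r cˢ≢0) ⟩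
      (c * cˢ ^ r) * (cˢ ^ r) ⁻¹       ≡⟨ *-assoc c _ _ ⟩
      c * (cˢ ^ r * (cˢ ^ r) ⁻¹)       ≡⟨ cong (c *_) (⁻¹-inverse _ (^-nonzero r cˢ≢0)) ⟩
      c * 1#                           ≡⟨ *-identityʳ c ⟩
      c                                ∎)
      where
      G = u * (D u * δ) ^ s
      cˢ = c ^ s
      cˢ≢0 = ^-nonzero s c≢0
      e = G * cˢ ⁻¹
      e∈K : InSubfield e
      e∈K = subfield-* (subfield-* u∈K (subfield-^ s (subfield-* (D-subfield u∈K) δ∈K)))
                       (subfield-⁻¹ (subfield-^ s c-subfield))
      e≢0 : e ≢ 0#
      e≢0 = *-nonzero (*-nonzero u≢0 (^-nonzero s (*-nonzero (D≢0 u∈K u≢0) δ≢0))) (⁻¹-nonzero cˢ≢0)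
      G^r≡ : G ^ r ≡ c * cˢ ^ r
      G^r≡ = begin
        G ^ r                            ≡⟨ ^-distrib-* u _ r ⟩
        u ^ r * ((D u * δ) ^ s) ^ r      ≡⟨ cong (u ^ r *_) (^-assocʳ (D u * δ) s r) ⟩
        u ^ r * (D u * δ) ^ (s ℕ.* r)    ≡⟨ cong (λ n → u ^ r * (D u * δ) ^ n) m≡s*r ⟨
        u ^ r * (D u * δ) ^ m            ≡⟨ cong (u ^ r *_) (^-distrib-* (D u) δ m) ⟩
        u ^ r * (D u ^ m * δ ^ m)        ≡⟨ *-assoc _ _ _ ⟨
        (u ^ r * D u ^ m) * δ ^ m        ≡⟨ cong (_* δ ^ m) (Φ^r≡ u∈K) ⟨
        Φ u ^ r * δ ^ m                  ≡⟨ Tδᵐ≡cᵖ ⟩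
        c * c ^ m                        ≡⟨ cong (λ n → c * c ^ n) m≡s*r ⟩
        c * c ^ (s ℕ.* r)                ≡⟨ cong (c *_) (^-assocʳ c s r) ⟨
        c * cˢ ^ r                       ∎

    w-injective : ∀ {u v} → InSubfield u → InSubfield v → u ≢ 0# → v ≢ 0# → Φ u ≡ Φ v → w u ≡ w v
    w-injective {u} {v} u∈K v∈K u≢0 v≢0 Φu≡Φv with w u + - w v ≟ 0#
    ... | yes δ≡0 = x-y≡0⇒x≡y _ _ δ≡0
    ... | no δ≢0  = contradiction Tδᵐ≡cᵖ (no-subfield-root u∈K u≢0 δ∈K δ≢0)
      where
      T = Φ u ^ r
      δ = w u + - w v
      δ∈K : InSubfield δ
      δ∈K = subfield-+ w∈K (subfield-neg w∈K′)
        where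
        w∈K  = subfield-* c-subfield (subfield-⁻¹ (D-subfield u∈K))
        w∈K′ = subfield-* c-subfield (subfield-⁻¹ (D-subfield v∈K))
      Tδᵖ≡cᵖδ : T * δ ^ suc m ≡ c ^ suc m * δ
      Tδᵖ≡cᵖδ = root-difference (w-equation u∈K u≢0)
                  (subst (λ z → z ^ r * w v ^ suc m ≡ c ^ suc m * (w v + 1#)) (sym Φu≡Φv) (w-equation v∈K v≢0))
      Tδᵐ≡cᵖ : T * δ ^ m ≡ c ^ suc m
      Tδᵐ≡cᵖ = *-cancelˡ δ≢0 (begin
        δ * (T * δ ^ m)     ≡⟨ x∙yz≈y∙xz δ T (δ ^ m) ⟩
        T * δ ^ suc m       ≡⟨ Tδᵖ≡cᵖδ ⟩
        c ^ suc m * δ       ≡⟨ *-comm _ δ ⟩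
        δ * c ^ suc m       ∎)

    Φ-injective : ∀ {u v} → InSubfield u → InSubfield v → u ≢ 0# → v ≢ 0# → Φ u ≡ Φ v → u ≡ v
    Φ-injective {u} {v} u∈K v∈K u≢0 v≢0 Φu≡Φv = *-cancelʳ (^-nonzero s (D≢0 u∈K u≢0)) (begin
      u * D u ^ s      ≡⟨ Φ≡ u∈K ⟨
      Φ u              ≡⟨ Φu≡Φv ⟩
      Φ v              ≡⟨ Φ≡ v∈K ⟩
      v * D v ^ s      ≡⟨ cong (λ z → v * z ^ s) Du≡Dv ⟨
      v * D u ^ s      ∎)
      where
      Du≡Dv : D u ≡ D v
      Du≡Dv = ⁻¹-injective (D≢0 u∈K u≢0) (D≢0 v∈K v≢0)
                (*-cancelˡ c≢0 (w-injective u∈K v∈K u≢0 v≢0 Φu≡Φv))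

    translate-nonzero : ∀ {u} → InSubfield u → u + a ≢ 0#
    translate-nonzero {u} u∈K u+a≡0 = ω≢1 (subfield⇒^R≡1 a∈K a≢0)
      where
      a∈K : InSubfield a
      a∈K = subst InSubfield (sym (x+y≡0⇒x≡-y a u (trans (+-comm a u) u+a≡0))) (subfield-neg u∈K)

    f g : Carrier → Carrier
    f x = a ⁻¹ * x ^ suc S
    g x = f x + x

    f-injective : Injective _≡_ _≡_ f
    f-injective fx≡fy = ^-injective 1+S⊥q-1 (*-cancelˡ (⁻¹-nonzero a≢0) fx≡fy)

    a*g≡ : ∀ x → a * g x ≡ x * (x ^ S + a)
    a*g≡ x = begin
      a * (a ⁻¹ * (x * x ^ S) + x)            ≡⟨ distribˡ a _ x ⟩
      a * (a ⁻¹ * (x * x ^ S)) + a * x        ≡⟨ cong (_+ a * x) (*-assoc a _ _) ⟨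
      (a * a ⁻¹) * (x * x ^ S) + a * x        ≡⟨ cong (λ z → z * (x * x ^ S) + a * x) (⁻¹-inverse a a≢0) ⟩
      1# * (x * x ^ S) + a * x                ≡⟨ solve 3 (λ x N a → con 1 :* (x :* N) :+ a :* x := x :* (N :+ a))
                                                       refl x (x ^ S) a ⟩
      x * (x ^ S + a)                         ∎

    a*g^S≡Φ : ∀ x → (a * g x) ^ S ≡ Φ (x ^ S)
    a*g^S≡Φ x = trans (cong (_^ S) (a*g≡ x)) (^-distrib-* x _ S)

    g0≡0 : g 0# ≡ 0#
    g0≡0 = trans (+-identityʳ _) (trans (cong (a ⁻¹ *_) (zeroˡ _)) (zeroʳ _))

    g-nonzero : ∀ {x} → x ≢ 0# → g x ≢ 0#
    g-nonzero {x} x≢0 gx≡0 = *-nonzero x≢0 (translate-nonzero (norm-subfield x≢0))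
      (trans (sym (a*g≡ x)) (trans (cong (a *_) gx≡0) (zeroʳ a)))

    g-injective : Injective _≡_ _≡_ g
    g-injective {x} {y} gx≡gy with x ≟ 0# | y ≟ 0#
    ... | yes x≡0 | yes y≡0 = trans x≡0 (sym y≡0)
    ... | yes refl | no y≢0 = contradiction (trans (sym gx≡gy) g0≡0) (g-nonzero y≢0)
    ... | no x≢0 | yes refl = contradiction (trans gx≡gy g0≡0) (g-nonzero x≢0)
    ... | no x≢0 | no y≢0 = *-cancelʳ (translate-nonzero (norm-subfield x≢0)) (begin
      x * (x ^ S + a)     ≡⟨ a*g≡ x ⟨
      a * g x             ≡⟨ cong (a *_) gx≡gy ⟩
      a * g y             ≡⟨ a*g≡ y ⟩
      y * (y ^ S + a)     ≡⟨ cong (λ z → y * (z + a)) xˢ≡yˢ ⟨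
      y * (x ^ S + a)     ∎)
      where
      xˢ≡yˢ : x ^ S ≡ y ^ S
      xˢ≡yˢ = Φ-injective (norm-subfield x≢0) (norm-subfield y≢0) (^-nonzero S x≢0) (^-nonzero S y≢0)
                (trans (sym (a*g^S≡Φ x)) (trans (cong (λ z → (a * z) ^ S) gx≡gy) (a*g^S≡Φ y)))

    isCPP : IsCPP f
    isCPP = injective⇒permutation f-injective , injective⇒permutation g-injective

  d≡1+S : .{{_ : NonZero R}} → (p ℕ.^ (m ℕ.* k) ∸ 1) ℕ./ R ℕ.+ 1 ≡ suc S
  d≡1+S = begin
    (p ℕ.^ (m ℕ.* k) ∸ 1) ℕ./ R ℕ.+ 1   ≡⟨ cong (λ n → (n ∸ 1) ℕ./ R ℕ.+ 1) q≡1+SR ⟩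
    (S ℕ.* R) ℕ./ R ℕ.+ 1               ≡⟨ cong (ℕ._+ 1) (m*n/n≡m S R) ⟩
    S ℕ.+ 1                             ≡⟨ ℕ.+-comm S 1 ⟩
    suc S                               ∎

mainTheorem3 : (p k n : ℕ) → Prime p → ¬ (2 ∣ p) → 1 ≤ k → 1 ≤ n → n ∣ (p ∸ 1) →
    .{{_ : NonZero ((p ℕ.^ k) ∸ 1)}} →
    (F : FiniteField (p ℕ.^ ((p ∸ 1) ℕ.* k))) →
    (a : FiniteField.Carrier F) →
    FiniteField.InMu F n (FiniteField._^_ F a ((p ℕ.^ k) ∸ 1)) →
    ¬ (FiniteField._^_ F a ((p ℕ.^ k) ∸ 1) ≡ FiniteField.1# F) →
    FiniteField.IsCPP F (λ x → FiniteField._*_ F (FiniteField._⁻¹ F a)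
    (FiniteField._^_ F x ((((p ℕ.^ ((p ∸ 1) ℕ.* k)) ∸ 1) ℕ./ ((p ℕ.^ k) ∸ 1)) ℕ.+ 1)))
mainTheorem3 p k n p-prime _ k≥1 _ n∣p-1 F a a^R∈μₙ a^R≢1 =
  subst (λ d → IsCPP (λ x → a ⁻¹ * x ^ d)) (sym d≡1+S) (isCPP (^≡1⇒^∣≡1 a^R∈μₙ n∣p-1) a^R≢1)
  where
  open FiniteFieldProperties F using (IsCPP; _⁻¹; _*_; _^_; ^≡1⇒^∣≡1)
  open CompletePermutation p-prime k≥1 F using (d≡1+S; isCPP)
  open import Relation.Binary.PropositionalEquality using (subst; sym)
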